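{- Let $n,d\ge1$ and let $(R_\alpha)_{\alpha\in\mathrm{Perm}(d)}$ be a family of subsets of $[n]^d$ each contained in the set $S=\{\mathbf x\in[n]^d: x_1\le x_2\le\dots\le x_d\}$ of non-decreasing tuples. The following are equivalent: (1) there exists $R\subseteq[n]^d$ such that $R_\alpha=\{\mathbf x\in S:\mathbf x_{\alpha^{ -1}}\in R\}$ for every $\alpha\in\mathrm{Perm}(d)$; (2) for all $\alpha,\beta\in\mathrm{Perm}(d)$ and all $\mathbf x\in[n]^d$: if $\mathbf x_\alpha=\mathbf x_\beta$ then ($\mathbf x_\alpha\in R_\alpha\iff\mathbf x_\beta\in R_\beta$); (3) for all $\alpha\in\mathrm{Perm}(d)$, every transposition $\tau$ of $[d]$, and all $\mathbf x\in[n]^d$: if $\mathbf x=\mathbf x_\tau$ then ($\mathbf x\in R_\alpha\iff\mathbf x\in R_{\alpha\tau}$).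
   Context: $[n]=\{1,\dots,n\}$. $\mathrm{Perm}(d)$ is the set of permutations of $[d]$; for $\alpha,\beta\in\mathrm{Perm}(d)$, $\alpha\beta$ denotes the composition $i\mapsto\alpha(\beta(i))$. For $\mathbf x=(x_1,\dots,x_d)$ and $\alpha\in\mathrm{Perm}(d)$, $\mathbf x_\alpha=(x_{\alpha(1)},\dots,x_{\alpha(d)})$; thus $(\mathbf x_\alpha)_\beta=\mathbf x_{\alpha\beta}$. -}

module Defs where

open import Data.Nat using (ℕ)
open import Data.Fin using (Fin; _≤_)
open import Data.Fin.Permutation using (Permutation′; _⟨$⟩ʳ_; _∘ₚ_; flip; transpose; _≈_)
open import Data.Vec using (Vec; lookup; tabulate)
open import Data.Product using (_×_; ∃)
open import Relation.Binary.PropositionalEquality using (_≡_)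
open import Relation.Nullary using (¬_)
open import Function.Bundles using (_⇔_)
open import Level using (0ℓ)
open import Relation.Unary using (Pred)

-- [n] is modelled by Fin n (0-based; order preserved), [n]^d by Vec (Fin n) d.
Tuple : ℕ → ℕ → Set
Tuple n d = Vec (Fin n) d

Rel' : ℕ → ℕ → Set₁
Rel' n d = Pred (Tuple n d) 0ℓ

-- Composition αβ : i ↦ α (β i)
_·_ : ∀ {d} → Permutation′ d → Permutation′ d → Permutation′ d
α · β = β ∘ₚ α

_⁻¹ : ∀ {d} → Permutation′ d → Permutation′ d
α ⁻¹ = flip α

_at_ : ∀ {n d} → Tuple n d → Permutation′ d → Tuple n d
x at α = tabulate (λ i → lookup x (α ⟨$⟩ʳ i))

NonDecr : ∀ {n d} → Tuple n d → Set
NonDecr {n} {d} x = ∀ (i j : Fin d) → i ≤ j → lookup x i ≤ lookup x j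

IsTransposition : ∀ {d} → Permutation′ d → Set
IsTransposition {d} τ = ∃ λ (i : Fin d) → ∃ λ (j : Fin d) → ¬ (i ≡ j) × (τ ≈ transpose i j)

Cond1 : ∀ {n d} → (Permutation′ d → Rel' n d) → Set₁
Cond1 {n} {d} Rf = ∃ λ (R : Rel' n d) →
  ∀ (α : Permutation′ d) (x : Tuple n d) → Rf α x ⇔ (NonDecr x × R (x at (α ⁻¹)))

Cond2 : ∀ {n d} → (Permutation′ d → Rel' n d) → Set
Cond2 {n} {d} Rf = ∀ (α β : Permutation′ d) (x : Tuple n d) →
  x at α ≡ x at β → Rf α (x at α) ⇔ Rf β (x at β)

Cond3 : ∀ {n d} → (Permutation′ d → Rel' n d) → Set
Cond3 {n} {d} Rf = ∀ (α τ : Permutation′ d) → IsTransposition τ → (x : Tuple n d) →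
  x ≡ x at τ → Rf α x ⇔ Rf (α · τ) x

module Submission where

-- (1) ⇒ (2) ⇒ (3) is rewriting with x_{αβ} = (x_α)_β. For (3) ⇒ (1) take
-- R = {z | z_β ∈ R_β for some β}. If x is non-decreasing and x_{α⁻¹} ∈ R, then
-- x_π ∈ R_β for π = α⁻¹β, so x_π is non-decreasing as well; a non-decreasing
-- rearrangement of a non-decreasing tuple is the tuple itself, hence x_π = x and
-- x ∈ R_β = R_{απ}. Finally the stabiliser of x is generated by the transpositions
-- τ with x = x_τ (fix the positions d−1, d−2, … one at a time), so by (3) x ∈ R_α.

open import Defs
open import Data.Nat using (ℕ; zero; suc; _≤_; z≤n)
import Data.Nat.Properties as ℕ
open import Data.Fin as F using (Fin; toℕ; fromℕ<)
import Data.Fin.Properties as FP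
open import Data.Fin.Permutation
  using (Permutation′; _≈_; _⟨$⟩ʳ_; _⟨$⟩ˡ_; id; transpose; inverseˡ; inverseʳ)
import Data.Fin.Permutation.Components as PC
open import Data.Vec using (lookup)
open import Data.Vec.Properties using (lookup∘tabulate; tabulate∘lookup; tabulate-cong)
open import Data.Product using (_×_; _,_; ∃)
open import Function.Bundles using (_⇔_; mk⇔; Equivalence)
import Function.Properties.Equivalence as ⇔
open import Function.Definitions using (Injective)
open import Relation.Nullary using (yes; no)
open import Relation.Nullary.Negation using (contradiction)
open import Relation.Binary.PropositionalEquality

open Equivalence using (to; from)

permutation-injective : ∀ {d} (π : Permutation′ d) → Injective _≡_ _≡_ (π ⟨$⟩ʳ_)
permutation-injective π {i} {j} πi≡πj = begin
  i                  ≡⟨ inverseˡ π ⟨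
  π ⟨$⟩ˡ (π ⟨$⟩ʳ i)  ≡⟨ cong (π ⟨$⟩ˡ_) πi≡πj ⟩
  π ⟨$⟩ˡ (π ⟨$⟩ʳ j)  ≡⟨ inverseˡ π ⟩
  j                  ∎
  where open ≡-Reasoning

transpose-atˡ : ∀ {d} (i j : Fin d) → PC.transpose i j i ≡ j
transpose-atˡ i j with i FP.≟ i
... | yes _   = refl
... | no i≢i = contradiction refl i≢i

transpose-fixes : ∀ {d} (i j k : Fin d) → k ≢ i → k ≢ j → PC.transpose i j k ≡ k
transpose-fixes i j k k≢i k≢j with k FP.≟ i
... | yes k≡i = contradiction k≡i k≢i
... | no _ with k FP.≟ j
...   | yes k≡j = contradiction k≡j k≢j
...   | no _    = refl

lookup-at : ∀ {n d} (x : Tuple n d) (α : Permutation′ d) i → lookup (x at α) i ≡ lookup x (α ⟨$⟩ʳ i)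
lookup-at x α = lookup∘tabulate _

at-cong : ∀ {n d} (x : Tuple n d) {α β : Permutation′ d} → α ≈ β → x at α ≡ x at β
at-cong x α≈β = tabulate-cong (λ i → cong (lookup x) (α≈β i))

at-id : ∀ {n d} (x : Tuple n d) → x at id ≡ x
at-id = tabulate∘lookup

at-· : ∀ {n d} (x : Tuple n d) (α β : Permutation′ d) → x at (α · β) ≡ (x at α) at β
at-· x α β = tabulate-cong (λ i → sym (lookup-at x α (β ⟨$⟩ʳ i)))

at-at-⁻¹ : ∀ {n d} (x : Tuple n d) (α : Permutation′ d) → (x at α) at (α ⁻¹) ≡ x
at-at-⁻¹ x α = begin
  (x at α) at (α ⁻¹)  ≡⟨ at-· x α (α ⁻¹) ⟨
  x at (α · (α ⁻¹))   ≡⟨ at-cong x {α · (α ⁻¹)} {id} (λ i → inverseʳ α {i}) ⟩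
  x at id             ≡⟨ at-id x ⟩
  x                   ∎
  where open ≡-Reasoning

at-⁻¹-at : ∀ {n d} (x : Tuple n d) (α : Permutation′ d) → (x at (α ⁻¹)) at α ≡ x
at-⁻¹-at x α = begin
  (x at (α ⁻¹)) at α  ≡⟨ at-· x (α ⁻¹) α ⟨
  x at ((α ⁻¹) · α)   ≡⟨ at-cong x {(α ⁻¹) · α} {id} (λ i → inverseˡ α {i}) ⟩
  x at id             ≡⟨ at-id x ⟩
  x                   ∎
  where open ≡-Reasoning

lookup-stable⇒at-stable : ∀ {n d} (x : Tuple n d) (α : Permutation′ d) →
                          (∀ i → lookup x (α ⟨$⟩ʳ i) ≡ lookup x i) → x at α ≡ x
lookup-stable⇒at-stable x α xα≗x = trans (tabulate-cong xα≗x) (tabulate∘lookup x)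

at-⁻¹-stable : ∀ {n d} (x : Tuple n d) (α : Permutation′ d) → x at α ≡ x → x at (α ⁻¹) ≡ x
at-⁻¹-stable x α xα≡x = trans (cong (_at (α ⁻¹)) (sym xα≡x)) (at-at-⁻¹ x α)

transpose-stable : ∀ {n d} (x : Tuple n d) (i j : Fin d) → lookup x i ≡ lookup x j →
                   x at transpose i j ≡ x
transpose-stable x i j xi≡xj = lookup-stable⇒at-stable x (transpose i j) stable
  where
  stable : ∀ k → lookup x (PC.transpose i j k) ≡ lookup x k
  stable k with k FP.≟ i
  ... | yes k≡i = trans (sym xi≡xj) (cong (lookup x) (sym k≡i))
  ... | no _ with k FP.≟ j
  ...   | yes k≡j = trans xi≡xj (cong (lookup x) (sym k≡j))
  ...   | no _    = refl

-- Injectivity of π gives a pivot l ≤ k with k ≤ π l, so x k ≤ x (π l) ≤ (x at π) k.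
nonDecr-rearrangement-≤ : ∀ {n d} (x : Tuple n d) (π : Permutation′ d) →
                          NonDecr x → NonDecr (x at π) → ∀ k → lookup x k F.≤ lookup (x at π) k
nonDecr-rearrangement-≤ x π x↑ xπ↑ k with FP.injective⇒existsPivot (permutation-injective π) k
... | l , l≤k , k≤πl = FP.≤-trans (x↑ k (π ⟨$⟩ʳ l) k≤πl)
                         (subst (F._≤ lookup (x at π) k) (lookup-at x π l) (xπ↑ l k l≤k))

nonDecr-rearrangement : ∀ {n d} (x : Tuple n d) (π : Permutation′ d) →
                        NonDecr x → NonDecr (x at π) → x at π ≡ x
nonDecr-rearrangement x π x↑ xπ↑ = lookup-stable⇒at-stable x π λ k →
  trans (sym (lookup-at x π k)) (FP.≤-antisym (below k) (nonDecr-rearrangement-≤ x π x↑ xπ↑ k))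
  where
  xπ⁻¹≡x : (x at π) at (π ⁻¹) ≡ x
  xπ⁻¹≡x = at-at-⁻¹ x π
  below : ∀ k → lookup (x at π) k F.≤ lookup x k
  below k = subst (λ y → lookup (x at π) k F.≤ lookup y k) xπ⁻¹≡x
    (nonDecr-rearrangement-≤ (x at π) (π ⁻¹) xπ↑ (subst NonDecr (sym xπ⁻¹≡x) x↑) k)

FixesFrom : ∀ {d} → ℕ → Permutation′ d → Set
FixesFrom m π = ∀ i → m ≤ toℕ i → π ⟨$⟩ʳ i ≡ i

fixesFrom-pred : ∀ {d} (π : Permutation′ d) (p : Fin d) →
                 FixesFrom (suc (toℕ p)) π → π ⟨$⟩ʳ p ≡ p → FixesFrom (toℕ p) π
fixesFrom-pred π p fix πp≡p i p≤i with i FP.≟ p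
... | yes refl = πp≡p
... | no i≢p   = fix i (ℕ.≤∧≢⇒< p≤i (λ p≡i → i≢p (FP.toℕ-injective (sym p≡i))))

fixing : ∀ {d} → Fin d → Permutation′ d → Permutation′ d
fixing p π = (transpose p (π ⟨$⟩ʳ p) ⁻¹) · π

module _ {d} (p : Fin d) (π : Permutation′ d) where

  fixing-fixes : fixing p π ⟨$⟩ʳ p ≡ p
  fixing-fixes = transpose-atˡ (π ⟨$⟩ʳ p) p

  fixing-fixesFrom : FixesFrom (suc (toℕ p)) π → FixesFrom (suc (toℕ p)) (fixing p π)
  fixing-fixesFrom fix i p<i =
    trans (cong (PC.transpose (π ⟨$⟩ʳ p) p) πi≡i) (transpose-fixes (π ⟨$⟩ʳ p) p i i≢πp i≢p)
    where
    πi≡i : π ⟨$⟩ʳ i ≡ i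
    πi≡i = fix i p<i
    i≢p : i ≢ p
    i≢p i≡p = ℕ.<-irrefl (cong toℕ (sym i≡p)) p<i
    i≢πp : i ≢ π ⟨$⟩ʳ p
    i≢πp i≡πp = i≢p (permutation-injective π (trans πi≡i i≡πp))

  at-transpose-moved : ∀ {n} (x : Tuple n d) → x at π ≡ x → x at transpose p (π ⟨$⟩ʳ p) ≡ x
  at-transpose-moved x xπ≡x = transpose-stable x p (π ⟨$⟩ʳ p)
    (trans (sym (cong (λ y → lookup y p) xπ≡x)) (lookup-at x π p))

  at-fixing : ∀ {n} (x : Tuple n d) → x at π ≡ x → x at fixing p π ≡ x
  at-fixing x xπ≡x = begin
    x at ((τ ⁻¹) · π)  ≡⟨ at-· x (τ ⁻¹) π ⟩
    (x at (τ ⁻¹)) at π ≡⟨ cong (_at π) (at-⁻¹-stable x τ (at-transpose-moved x xπ≡x)) ⟩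
    x at π             ≡⟨ xπ≡x ⟩
    x                  ∎
    where
    open ≡-Reasoning
    τ : Permutation′ d
    τ = transpose p (π ⟨$⟩ʳ p)

-- The stabiliser of x is generated by the transpositions in it.
module _ {n d} (F : Permutation′ d → Set) (F-cong : ∀ α β → α ≈ β → F α ⇔ F β) (x : Tuple n d)
         (F-transpose : ∀ α τ → IsTransposition τ → x ≡ x at τ → F α ⇔ F (α · τ)) where

  stabiliser-invariant-step : ∀ (p : Fin d) π → x at π ≡ x → FixesFrom (suc (toℕ p)) π →
    (∀ σ → x at σ ≡ x → FixesFrom (toℕ p) σ → ∀ α → F α ⇔ F (α · σ)) →
    ∀ α → F α ⇔ F (α · π)
  stabiliser-invariant-step p π xπ≡x fix ih α with π ⟨$⟩ʳ p FP.≟ p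
  ... | yes πp≡p = ih π xπ≡x (fixesFrom-pred π p fix πp≡p) α
  ... | no πp≢p  = ⇔.trans (F-transpose α τ τ-transposition (sym (at-transpose-moved p π x xπ≡x)))
                  (⇔.trans (ih π′ (at-fixing p π x xπ≡x) π′-fixesFrom (α · τ))
                    (F-cong ((α · τ) · π′) (α · π) (λ i → cong (α ⟨$⟩ʳ_) (inverseʳ τ))))
    where
    τ : Permutation′ d
    τ = transpose p (π ⟨$⟩ʳ p)
    τ-transposition : IsTransposition τ
    τ-transposition = p , π ⟨$⟩ʳ p , (λ p≡πp → πp≢p (sym p≡πp)) , (λ _ → refl)
    π′ : Permutation′ d
    π′ = fixing p π
    π′-fixesFrom : FixesFrom (toℕ p) π′
    π′-fixesFrom = fixesFrom-pred π′ p (fixing-fixesFrom p π fix) (fixing-fixes p π)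

  stabiliser-invariant-from : ∀ m → m ≤ d → ∀ π → x at π ≡ x → FixesFrom m π →
                              ∀ α → F α ⇔ F (α · π)
  stabiliser-invariant-from zero    _   π _    fix α =
    F-cong α (α · π) (λ i → cong (α ⟨$⟩ʳ_) (sym (fix i z≤n)))
  stabiliser-invariant-from (suc m) m<d π xπ≡x fix =
    stabiliser-invariant-step p π xπ≡x (subst (λ k → FixesFrom (suc k) π) (sym p≡m) fix)
      λ σ xσ≡x fixσ → stabiliser-invariant-from m (ℕ.<⇒≤ m<d) σ xσ≡x
                        (subst (λ k → FixesFrom k σ) p≡m fixσ)
    where
    p : Fin d
    p = fromℕ< m<d
    p≡m : toℕ p ≡ m
    p≡m = FP.toℕ-fromℕ< m<d

  stabiliser-invariant : ∀ π → x at π ≡ x → ∀ α → F α ⇔ F (α · π)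
  stabiliser-invariant π xπ≡x =
    stabiliser-invariant-from d ℕ.≤-refl π xπ≡x (λ i d≤i → contradiction (FP.toℕ<n i) (ℕ.≤⇒≯ d≤i))

module _ {n d} (Rf : Permutation′ d → Rel' n d) where

  cond1⇒cond2 : Cond1 Rf → Cond2 Rf
  cond1⇒cond2 (R , Rf≡S∩R) α β x xα≡xβ =
    ⇔.trans (subst (λ y → Rf α (x at α) ⇔ (NonDecr y × R x)) xα≡xβ (characterisation α))
            (⇔.sym (characterisation β))
    where
    characterisation : ∀ γ → Rf γ (x at γ) ⇔ (NonDecr (x at γ) × R x)
    characterisation γ = subst (λ y → Rf γ (x at γ) ⇔ (NonDecr (x at γ) × R y))
                               (at-at-⁻¹ x γ) (Rf≡S∩R γ (x at γ))

  cond2⇒cond3 : Cond2 Rf → Cond3 Rf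
  cond2⇒cond3 c2 α τ _ x x≡xτ =
    subst₂ (λ u v → Rf α u ⇔ Rf (α · τ) v) yα≡x yατ≡x (c2 α (α · τ) y (trans yα≡x (sym yατ≡x)))
    where
    y : Tuple n d
    y = x at (α ⁻¹)
    yα≡x : y at α ≡ x
    yα≡x = at-⁻¹-at x α
    yατ≡x : y at (α · τ) ≡ x
    yατ≡x = trans (at-· y α τ) (trans (cong (_at τ) yα≡x) (sym x≡xτ))

  cond3⇒stabiliser-invariant : (∀ α β → α ≈ β → ∀ x → Rf α x ⇔ Rf β x) → Cond3 Rf →
                               ∀ x π → x at π ≡ x → ∀ α → Rf α x ⇔ Rf (α · π) x
  cond3⇒stabiliser-invariant Rf-cong c3 x =
    stabiliser-invariant (λ α → Rf α x) (λ α β α≈β → Rf-cong α β α≈β x) x (λ α τ t → c3 α τ t x)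

  cond3⇒cond1 : (∀ α x → Rf α x → NonDecr x) → (∀ α β → α ≈ β → ∀ x → Rf α x ⇔ Rf β x) →
                Cond3 Rf → Cond1 Rf
  cond3⇒cond1 Rf⊆S Rf-cong c3 = R , λ α x → mk⇔ (Rf⊆S∩R α x) (S∩R⊆Rf α x)
    where
    R : Rel' n d
    R z = ∃ λ β → Rf β (z at β)
    Rf⊆S∩R : ∀ α x → Rf α x → NonDecr x × R (x at (α ⁻¹))
    Rf⊆S∩R α x h = Rf⊆S α x h , α , subst (Rf α) (sym (at-⁻¹-at x α)) h
    S∩R⊆Rf : ∀ α x → NonDecr x × R (x at (α ⁻¹)) → Rf α x
    S∩R⊆Rf α x (x↑ , β , h) = from (cond3⇒stabiliser-invariant Rf-cong c3 x π xπ≡x α) Rf-απ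
      where
      π : Permutation′ d
      π = (α ⁻¹) · β
      Rf-βxπ : Rf β (x at π)
      Rf-βxπ = subst (Rf β) (sym (at-· x (α ⁻¹) β)) h
      xπ≡x : x at π ≡ x
      xπ≡x = nonDecr-rearrangement x π x↑ (Rf⊆S β (x at π) Rf-βxπ)
      Rf-απ : Rf (α · π) x
      Rf-απ = to (Rf-cong β (α · π) (λ i → sym (inverseʳ α)) x) (subst (Rf β) xπ≡x Rf-βxπ)

lemma4 : (n d : ℕ) → 1 ≤ n → 1 ≤ d →
    (Rf : Permutation′ d → Rel' n d) →
    (∀ α x → Rf α x → NonDecr x) →
    (∀ α β → α ≈ β → ∀ x → Rf α x ⇔ Rf β x) →
    ((Cond1 Rf → Cond2 Rf) × (Cond2 Rf → Cond3 Rf) × (Cond3 Rf → Cond1 Rf))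
lemma4 n d _ _ Rf Rf⊆S Rf-cong = cond1⇒cond2 Rf , cond2⇒cond3 Rf , cond3⇒cond1 Rf Rf⊆S Rf-cong
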